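{- For any set of rule schemes $\mathcal{R}\subseteq\{N,H,P,F,wF\}$, the logic $i\mathbf{STL}(\mathcal{R})$ is sound with respect to all $\mathbf{K}(\mathcal{R})$-Kripke models: if $i\mathbf{STL}(\mathcal{R})\vdash\Gamma\Rightarrow A$, then $\Gamma\Rightarrow A$ is valid in every $\mathbf{K}(\mathcal{R})$-Kripke model.
   Context: Language $\mathcal{L}_\nabla$: formulas from atoms and constants $\top,\bot,1$ by $\wedge,\vee,\otimes,\to$ and unary $\nabla$; sequents $\Gamma\Rightarrow A$ with $\Gamma$ a finite sequence, $\nabla\Gamma$ applying $\nabla$ to each member. $\mathbf{STL}$: axioms $A\Rightarrow A$; $\Rightarrow1$; $\nabla1\Rightarrow1$; $\Gamma\Rightarrow\top$; $\Gamma,\bot,\Sigma\Rightarrow A$; cut (from $\Gamma\Rightarrow A$, $\Pi,A,\Sigma\Rightarrow B$ infer $\Pi,\Gamma,\Sigma\Rightarrow B$); $L\wedge$ (from $\Gamma,A,\Sigma\Rightarrow C$ infer $\Gamma,A\wedge B,\Sigma\Rightarrow C$ and $\Gamma,B\wedge A,\Sigma\Rightarrow C$); $R\wedge$ (from $\Gamma\Rightarrow A,\Gamma\Rightarrow B$ infer $\Gamma\Rightarrow A\wedge B$); $L\vee$ (from $\Gamma,A,\Sigma\Rightarrow C$ and $\Gamma,B,\Sigma\Rightarrow C$ infer $\Gamma,A\vee B,\Sigma\Rightarrow C$); $R\vee$ (from $\Gamma\Rightarrow A$ infer $\Gamma\Rightarrow A\vee B$ and $\Gamma\Rightarrow B\vee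 A$); $L1$ (from $\Gamma,\Sigma\Rightarrow A$ infer $\Gamma,1,\Sigma\Rightarrow A$); $L\otimes$ (from $\Gamma,A,B,\Sigma\Rightarrow C$ infer $\Gamma,A\otimes B,\Sigma\Rightarrow C$); $R\otimes$ (from $\Gamma\Rightarrow A$, $\Sigma\Rightarrow B$ infer $\Gamma,\Sigma\Rightarrow A\otimes B$); $\nabla$ (from $A\Rightarrow B$ infer $\nabla A\Rightarrow\nabla B$); Oplax (from $\nabla A,\nabla B\Rightarrow C$ infer $\nabla(A\otimes B)\Rightarrow C$); $L\to$ (from $\Gamma\Rightarrow A$ and $\Pi,B,\Sigma\Rightarrow C$ infer $\Pi,\Gamma,\nabla(A\to B),\Sigma\Rightarrow C$); $R\to$ (from $A,\nabla\Gamma\Rightarrow B$ infer $\Gamma\Rightarrow A\to B$). Schemes: $(N)$ from $\Gamma\Rightarrow A$ infer $\nabla\Gamma\Rightarrow\nabla A$; $(P)$ from $\Gamma\Rightarrow\nabla A$ infer $\Gamma\Rightarrow A$; $(F)$ from $\Gamma\Rightarrow A$ infer $\Gamma\Rightarrow\nabla A$; $(wF)$ from $\nabla A\Rightarrow\bot$ infer $A\Rightarrow\bot$; $(H)$ from $\Gamma,A_1\to B_1,\dots,A_n\to B_n\Rightarrow C$ infer $\nabla\Gamma,\nabla A_1\to\nabla B_1,\dots,\nabla A_n\to\nabla B_n\Rightarrow\nabla C$. $i\mathbf{STL}(\mathcal{R})$ is $\mathbf{STL}$ plus the schemes in $\mathcal{R}$ plus left weakening, contraction and exchange. A Kripke model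 is $\mathcal{K}=(W,\leq,R,V)$ with $(W,\leq)$ a poset, $R\subseteq W\times W$ compatible with $\leq$ (if $(u,v)\in R$, $u'\leq u$, $v\leq v'$ then $(u',v')\in R$), and $V$ assigning to each atom an upset of $(W,\leq)$. Forcing: $w\Vdash p$ iff $w\in V(p)$; $w\Vdash\top$ and $w\Vdash 1$ always; never $w\Vdash\bot$; $\wedge$ and $\otimes$ are both interpreted as conjunction, $\vee$ as disjunction; $w\Vdash A\to B$ iff for every $v$ with $(w,v)\in R$, $v\Vdash A$ implies $v\Vdash B$; $w\Vdash\nabla A$ iff there is $v$ with $(v,w)\in R$ and $v\Vdash A$. $\Gamma\Rightarrow A$ is valid in $\mathcal{K}$ if every $w$ forcing all members of $\Gamma$ forces $A$. $\mathcal{K}$ is normal if there is an order preserving $\pi:W\to W$ with $(u,v)\in R$ iff $u\leq\pi(v)$. Conditions: $(N)$ normal; $(H)$ normal with $\pi$ a poset isomorphism; $(P)$ $R\subseteq\leq$; $(F)$ $R$ reflexive; $(wF)$ $R$ serial (every $u$ has $v$ with $(u,v)\in R$). A $\mathbf{K}(\mathcal{R})$-Kripke model is one satisfying the conditions for all schemes in $\mathcal{R}$. -}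

module Defs where

open import Data.Nat using (ℕ)
open import Data.Bool using (Bool; T)
open import Data.List using (List; []; _∷_; _++_; map; [_])
open import Data.List.Relation.Unary.All using (All)
open import Data.Product using (Σ; _×_; _,_; ∃)
open import Data.Sum using (_⊎_)
open import Data.Unit using (⊤)
open import Data.Empty using (⊥)
open import Relation.Binary.PropositionalEquality using (_≡_)
open import Relation.Binary.Structures using (IsPartialOrder)
open import Function using (_⇔_)

infixr 5 _⇒_
infixr 6 _∧_ _∨_ _⊗_

data Fm : Set where
  atom : ℕ → Fm
  ⊤'   : Fm
  ⊥'   : Fm
  𝟙    : Fm
  _∧_  : Fm → Fm → Fm
  _∨_  : Fm → Fm → Fm
  _⊗_  : Fm → Fm → Fm
  _⇒_  : Fm → Fm → Fm
  ∇    : Fm → Fm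

∇* : List Fm → List Fm
∇* = map ∇

imps : List (Fm × Fm) → List Fm
imps = map (λ { (a , b) → a ⇒ b })

∇imps : List (Fm × Fm) → List Fm
∇imps = map (λ { (a , b) → ∇ a ⇒ ∇ b })

data Scheme : Set where
  N H P F wF : Scheme

SchemeSet : Set
SchemeSet = Scheme → Bool

infix 3 _⊢[_]_

data _⊢[_]_ : List Fm → SchemeSet → Fm → Set where
  ax     : ∀ {R A} → [ A ] ⊢[ R ] A
  ax1    : ∀ {R} → [] ⊢[ R ] 𝟙
  ax∇1   : ∀ {R} → [ ∇ 𝟙 ] ⊢[ R ] 𝟙
  ax⊤    : ∀ {R Γ} → Γ ⊢[ R ] ⊤'
  ax⊥    : ∀ {R Γ Σ A} → Γ ++ ⊥' ∷ Σ ⊢[ R ] A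
  cut    : ∀ {R Γ Π Σ A B} → Γ ⊢[ R ] A → Π ++ A ∷ Σ ⊢[ R ] B →
           Π ++ Γ ++ Σ ⊢[ R ] B
  L∧₁    : ∀ {R Γ Σ A B C} → Γ ++ A ∷ Σ ⊢[ R ] C → Γ ++ (A ∧ B) ∷ Σ ⊢[ R ] C
  L∧₂    : ∀ {R Γ Σ A B C} → Γ ++ A ∷ Σ ⊢[ R ] C → Γ ++ (B ∧ A) ∷ Σ ⊢[ R ] C
  R∧     : ∀ {R Γ A B} → Γ ⊢[ R ] A → Γ ⊢[ R ] B → Γ ⊢[ R ] A ∧ B
  L∨     : ∀ {R Γ Σ A B C} → Γ ++ A ∷ Σ ⊢[ R ] C → Γ ++ B ∷ Σ ⊢[ R ] C →
           Γ ++ (A ∨ B) ∷ Σ ⊢[ R ] C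
  R∨₁    : ∀ {R Γ A B} → Γ ⊢[ R ] A → Γ ⊢[ R ] A ∨ B
  R∨₂    : ∀ {R Γ A B} → Γ ⊢[ R ] A → Γ ⊢[ R ] B ∨ A
  L1     : ∀ {R Γ Σ A} → Γ ++ Σ ⊢[ R ] A → Γ ++ 𝟙 ∷ Σ ⊢[ R ] A
  L⊗     : ∀ {R Γ Σ A B C} → Γ ++ A ∷ B ∷ Σ ⊢[ R ] C → Γ ++ (A ⊗ B) ∷ Σ ⊢[ R ] C
  R⊗     : ∀ {R Γ Σ A B} → Γ ⊢[ R ] A → Σ ⊢[ R ] B → Γ ++ Σ ⊢[ R ] A ⊗ B
  ∇-rule : ∀ {R A B} → [ A ] ⊢[ R ] B → [ ∇ A ] ⊢[ R ] ∇ B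
  oplax  : ∀ {R A B C} → ∇ A ∷ ∇ B ∷ [] ⊢[ R ] C → [ ∇ (A ⊗ B) ] ⊢[ R ] C
  L→     : ∀ {R Γ Π Σ A B C} → Γ ⊢[ R ] A → Π ++ B ∷ Σ ⊢[ R ] C →
           Π ++ Γ ++ ∇ (A ⇒ B) ∷ Σ ⊢[ R ] C
  R→     : ∀ {R Γ A B} → A ∷ ∇* Γ ⊢[ R ] B → Γ ⊢[ R ] A ⇒ B
  weakL  : ∀ {R Γ Σ A C} → Γ ++ Σ ⊢[ R ] C → Γ ++ A ∷ Σ ⊢[ R ] C
  contrL : ∀ {R Γ Σ A C} → Γ ++ A ∷ A ∷ Σ ⊢[ R ] C → Γ ++ A ∷ Σ ⊢[ R ] C
  exchL  : ∀ {R Γ Σ A B C} → Γ ++ A ∷ B ∷ Σ ⊢[ R ] C → Γ ++ B ∷ A ∷ Σ ⊢[ R ] C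
  ruleN  : ∀ {R Γ A} → T (R N) → Γ ⊢[ R ] A → ∇* Γ ⊢[ R ] ∇ A
  ruleP  : ∀ {R Γ A} → T (R P) → Γ ⊢[ R ] ∇ A → Γ ⊢[ R ] A
  ruleF  : ∀ {R Γ A} → T (R F) → Γ ⊢[ R ] A → Γ ⊢[ R ] ∇ A
  rulewF : ∀ {R A} → T (R wF) → [ ∇ A ] ⊢[ R ] ⊥' → [ A ] ⊢[ R ] ⊥'
  ruleH  : ∀ {R Γ C} (ABs : List (Fm × Fm)) → T (R H) →
           Γ ++ imps ABs ⊢[ R ] C → ∇* Γ ++ ∇imps ABs ⊢[ R ] ∇ C

record KripkeModel : Set₁ where
  field
    W      : Set
    _≤_    : W → W → Set
    isPO   : IsPartialOrder _≡_ _≤_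
    Rel    : W → W → Set
    compat : ∀ {u v u′ v′} → Rel u v → u′ ≤ u → v ≤ v′ → Rel u′ v′
    V      : ℕ → W → Set
    V-up   : ∀ {p u v} → u ≤ v → V p u → V p v

  _⊩_ : W → Fm → Set
  w ⊩ atom p = V p w
  w ⊩ ⊤'     = ⊤
  w ⊩ ⊥'     = ⊥
  w ⊩ 𝟙      = ⊤
  w ⊩ (A ∧ B) = (w ⊩ A) × (w ⊩ B)
  w ⊩ (A ∨ B) = (w ⊩ A) ⊎ (w ⊩ B)
  w ⊩ (A ⊗ B) = (w ⊩ A) × (w ⊩ B)
  w ⊩ (A ⇒ B) = ∀ v → Rel w v → v ⊩ A → v ⊩ B
  w ⊩ ∇ A    = Σ W (λ v → Rel v w × (v ⊩ A))

open KripkeModel public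

Valid : KripkeModel → List Fm → Fm → Set
Valid K Γ A = ∀ (w : W K) → All (λ B → _⊩_ K w B) Γ → _⊩_ K w A

Monotone : (K : KripkeModel) → (W K → W K) → Set
Monotone K π = ∀ {u v} → _≤_ K u v → _≤_ K (π u) (π v)

Normal : KripkeModel → Set
Normal K = Σ (W K → W K) λ π → Monotone K π ×
           (∀ u v → Rel K u v ⇔ _≤_ K u (π v))

NormalIso : KripkeModel → Set
NormalIso K = Σ (W K → W K) λ π → Σ (W K → W K) λ ψ →
  Monotone K π × Monotone K ψ ×
  (∀ w → π (ψ w) ≡ w) × (∀ w → ψ (π w) ≡ w) ×
  (∀ u v → Rel K u v ⇔ _≤_ K u (π v))

Cond : Scheme → KripkeModel → Set
Cond N  K = Normal K
Cond H  K = NormalIso K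
Cond P  K = ∀ u v → Rel K u v → _≤_ K u v
Cond F  K = ∀ u → Rel K u u
Cond wF K = ∀ u → Σ (W K) λ v → Rel K u v

IsKModel : SchemeSet → KripkeModel → Set
IsKModel R K = ∀ s → T (R s) → Cond s K

module Submission where

-- For N and H
--    the point is that in a normal model (u,v) ∈ R iff u ≤ π v, so forcing
--    ∇A at w amounts to forcing A at π w; when π is moreover an order
--    isomorphism, ∇A ⇒ ∇B at w also transfers to A ⇒ B at π w.

open import Defs hiding (W; _≤_; isPO; Rel; compat; V; V-up; _⊩_)
open import Data.List using (List; []; _∷_; _++_)
open import Data.List.Relation.Unary.All using (All; []; _∷_)
open import Data.List.Relation.Unary.All.Properties using (++⁻; ++⁺)
open import Data.Product using (Σ; _×_; _,_)
open import Data.Sum using (inj₁; inj₂)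
open import Data.Unit using (tt)
open import Relation.Binary.PropositionalEquality using (_≡_; sym; subst; subst₂)
open import Relation.Binary.Structures using (IsPartialOrder)
open import Function.Bundles using (Equivalence; _⇔_)

module _ {a p} {X : Set a} {P : X → Set p} where

  All-split : ∀ Γ {x Σ} → All P (Γ ++ x ∷ Σ) → All P Γ × P x × All P Σ
  All-split Γ ps with ++⁻ Γ ps
  ... | pΓ , (px ∷ pΣ) = pΓ , px , pΣ

  All-join : ∀ {Γ x Σ} → All P Γ → P x → All P Σ → All P (Γ ++ x ∷ Σ)
  All-join pΓ px pΣ = ++⁺ pΓ (px ∷ pΣ)

module Model (K : KripkeModel) where
  open KripkeModel K using (W; _≤_; isPO; Rel; compat; V-up; _⊩_)

  ≤-refl : ∀ {u} → u ≤ u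
  ≤-refl = IsPartialOrder.refl isPO

  ⊩-mono : ∀ A {u v} → u ≤ v → u ⊩ A → v ⊩ A
  ⊩-mono (atom p) u≤v x       = V-up u≤v x
  ⊩-mono ⊤'       u≤v x       = x
  ⊩-mono ⊥'       u≤v x       = x
  ⊩-mono 𝟙        u≤v x       = x
  ⊩-mono (A ∧ B)  u≤v (x , y) = ⊩-mono A u≤v x , ⊩-mono B u≤v y
  ⊩-mono (A ∨ B)  u≤v (inj₁ x) = inj₁ (⊩-mono A u≤v x)
  ⊩-mono (A ∨ B)  u≤v (inj₂ y) = inj₂ (⊩-mono B u≤v y)
  ⊩-mono (A ⊗ B)  u≤v (x , y) = ⊩-mono A u≤v x , ⊩-mono B u≤v y
  ⊩-mono (A ⇒ B)  u≤v f       = λ x r a → f x (compat r u≤v ≤-refl) a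
  ⊩-mono (∇ A)    u≤v (x , r , a) = x , compat r ≤-refl u≤v , a

  ∇*-along : ∀ Δ {w v} → Rel w v → All (w ⊩_) Δ → All (v ⊩_) (∇* Δ)
  ∇*-along []      r []       = []
  ∇*-along (D ∷ Δ) r (d ∷ ds) = (_ , r , d) ∷ ∇*-along Δ r ds

  P-sound : (∀ u v → Rel u v → u ≤ v) →
            ∀ Γ A → Valid K Γ (∇ A) → Valid K Γ A
  P-sound R⊆≤ Γ A d w ws with d w ws
  ... | v , r , a = ⊩-mono A (R⊆≤ v w r) a

  F-sound : (∀ u → Rel u u) → ∀ Γ A → Valid K Γ A → Valid K Γ (∇ A)
  F-sound refl-R Γ A d w ws = w , refl-R w , d w ws

  -- Scheme wF: if R is serial, A is refutable as soon as ∇A is, since every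
  -- world forcing A makes its successor force ∇A.
  wF-sound : (∀ u → Σ W (λ v → Rel u v)) →
             ∀ A → Valid K (∇ A ∷ []) ⊥' → Valid K (A ∷ []) ⊥'
  wF-sound serial A d w (a ∷ []) with serial w
  ... | v , r = d v ((w , r , a) ∷ [])

  module Normal (π : W → W) (R⇔ : ∀ u v → Rel u v ⇔ (u ≤ π v)) where

    R⇒≤π : ∀ {u v} → Rel u v → u ≤ π v
    R⇒≤π = Equivalence.to (R⇔ _ _)

    ≤π⇒R : ∀ {u v} → u ≤ π v → Rel u v
    ≤π⇒R = Equivalence.from (R⇔ _ _)

    -- π w is the greatest R-predecessor of w, so ∇A at w is A at π w.
    ∇-at-π : ∀ A {w} → w ⊩ ∇ A → π w ⊩ A
    ∇-at-π A (v , r , a) = ⊩-mono A (R⇒≤π r) a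

    π-to-∇ : ∀ A {w} → π w ⊩ A → w ⊩ ∇ A
    π-to-∇ A a = _ , ≤π⇒R ≤-refl , a

    ∇*-at-π : ∀ Γ {w} → All (w ⊩_) (∇* Γ) → All (π w ⊩_) Γ
    ∇*-at-π []      []       = []
    ∇*-at-π (G ∷ Γ) (g ∷ gs) = ∇-at-π G g ∷ ∇*-at-π Γ gs

    N-sound : ∀ Γ A → Valid K Γ A → Valid K (∇* Γ) (∇ A)
    N-sound Γ A d w ws = π-to-∇ A (d (π w) (∇*-at-π Γ ws))

    -- If moreover π is an order isomorphism with monotone inverse ψ, then
    -- ∇A ⇒ ∇B at w yields A ⇒ B at π w: an R-successor x of π w has
    -- w ≤ x, ψ x is an R-successor of w whose ∇-witness is x itself, and the
    -- ∇B obtained at ψ x is witnessed below π (ψ x) = x.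
    module Iso (ψ : W → W) (ψ-mono : Monotone K ψ)
               (πψ : ∀ w → π (ψ w) ≡ w) (ψπ : ∀ w → ψ (π w) ≡ w) where

      -- π reflects the order, as ψ is a monotone left inverse of it.
      π-reflects : ∀ {u w} → π u ≤ π w → u ≤ w
      π-reflects {u} {w} le = subst₂ _≤_ (ψπ u) (ψπ w) (ψ-mono le)

      ≤-to-Rψ : ∀ {u x} → u ≤ x → Rel u (ψ x)
      ≤-to-Rψ {u} {x} le = ≤π⇒R (subst (u ≤_) (sym (πψ x)) le)

      ∇⇒-at-π : ∀ A B {w} → w ⊩ (∇ A ⇒ ∇ B) → π w ⊩ (A ⇒ B)
      ∇⇒-at-π A B {w} f x r a
        with f (ψ x) (≤-to-Rψ (π-reflects (R⇒≤π r)))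
               (x , ≤-to-Rψ ≤-refl , a)
      ... | z , rz , b = ⊩-mono B (subst (z ≤_) (πψ x) (R⇒≤π rz)) b

      ∇imps-at-π : ∀ ABs {w} → All (w ⊩_) (∇imps ABs) → All (π w ⊩_) (imps ABs)
      ∇imps-at-π []             []       = []
      ∇imps-at-π ((A , B) ∷ ABs) (f ∷ fs) = ∇⇒-at-π A B f ∷ ∇imps-at-π ABs fs

      H-sound : ∀ Γ ABs C → Valid K (Γ ++ imps ABs) C →
                Valid K (∇* Γ ++ ∇imps ABs) (∇ C)
      H-sound Γ ABs C d w ws with ++⁻ (∇* Γ) ws
      ... | gs , hs = π-to-∇ C (d (π w) (++⁺ (∇*-at-π Γ gs) (∇imps-at-π ABs hs)))

module Soundness (R : SchemeSet) (K : KripkeModel) (K-ok : IsKModel R K) where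
  open Model K

  sound : ∀ {Γ A} → Γ ⊢[ R ] A → Valid K Γ A
  sound ax       w (a ∷ []) = a
  sound ax1      w _ = tt
  sound ax∇1     w _ = tt
  sound ax⊤      w _ = tt
  sound (ax⊥ {Γ = Γ}) w ws with All-split Γ ws
  ... | _ , () , _
  sound (cut {Γ = Γ} {Π = Π} d e) w ws with ++⁻ Π ws
  ... | wΠ , wΓΣ with ++⁻ Γ wΓΣ
  ... | wΓ , wΣ = sound e w (All-join wΠ (sound d w wΓ) wΣ)
  sound (L∧₁ {Γ = Γ} d) w ws with All-split Γ ws
  ... | wΓ , (a , _) , wΣ = sound d w (All-join wΓ a wΣ)
  sound (L∧₂ {Γ = Γ} d) w ws with All-split Γ ws
  ... | wΓ , (_ , a) , wΣ = sound d w (All-join wΓ a wΣ)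
  sound (R∧ d e) w ws = sound d w ws , sound e w ws
  sound (L∨ {Γ = Γ} d e) w ws with All-split Γ ws
  ... | wΓ , inj₁ a , wΣ = sound d w (All-join wΓ a wΣ)
  ... | wΓ , inj₂ b , wΣ = sound e w (All-join wΓ b wΣ)
  sound (R∨₁ d) w ws = inj₁ (sound d w ws)
  sound (R∨₂ d) w ws = inj₂ (sound d w ws)
  sound (L1 {Γ = Γ} d) w ws with All-split Γ ws
  ... | wΓ , _ , wΣ = sound d w (++⁺ wΓ wΣ)
  sound (L⊗ {Γ = Γ} d) w ws with All-split Γ ws
  ... | wΓ , (a , b) , wΣ = sound d w (++⁺ wΓ (a ∷ b ∷ wΣ))
  sound (R⊗ {Γ = Γ} d e) w ws with ++⁻ Γ ws
  ... | wΓ , wΣ = sound d w wΓ , sound e w wΣ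
  sound (∇-rule d) w ((v , r , a) ∷ []) = v , r , sound d v (a ∷ [])
  sound (oplax d) w ((v , r , (a , b)) ∷ []) =
    sound d w ((v , r , a) ∷ (v , r , b) ∷ [])
  sound (L→ {Γ = Γ} {Π = Π} d e) w ws with ++⁻ Π ws
  ... | wΠ , rest with All-split Γ rest
  ... | wΓ , (v , r , f) , wΣ = sound e w (All-join wΠ (f w r (sound d w wΓ)) wΣ)
  sound (R→ {Γ = Γ} d) w ws = λ v r a → sound d v (a ∷ ∇*-along Γ r ws)
  sound (weakL {Γ = Γ} d) w ws with All-split Γ ws
  ... | wΓ , _ , wΣ = sound d w (++⁺ wΓ wΣ)
  sound (contrL {Γ = Γ} d) w ws with All-split Γ ws
  ... | wΓ , a , wΣ = sound d w (++⁺ wΓ (a ∷ a ∷ wΣ))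
  sound (exchL {Γ = Γ} d) w ws with ++⁻ Γ ws
  ... | wΓ , (b ∷ a ∷ wΣ) = sound d w (++⁺ wΓ (a ∷ b ∷ wΣ))
  sound (ruleN {Γ = Γ} {A = A} t d) with K-ok N t
  ... | π , _ , R⇔ = Normal.N-sound π R⇔ Γ A (sound d)
  sound (ruleP {Γ = Γ} {A = A} t d) = P-sound (K-ok P t) Γ A (sound d)
  sound (ruleF {Γ = Γ} {A = A} t d) = F-sound (K-ok F t) Γ A (sound d)
  sound (rulewF {A = A} t d) = wF-sound (K-ok wF t) A (sound d)
  sound (ruleH {Γ = Γ} {C = C} ABs t d) with K-ok H t
  ... | π , ψ , _ , ψ-mono , πψ , ψπ , R⇔ =
    Normal.Iso.H-sound π R⇔ ψ ψ-mono πψ ψπ Γ ABs C (sound d)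

theorem8p5 : (R : SchemeSet) (Γ : List Fm) (A : Fm) →
    Γ ⊢[ R ] A → (K : KripkeModel) → IsKModel R K → Valid K Γ A
theorem8p5 R Γ A d K K-ok = Soundness.sound R K K-ok d
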